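{- Let $\lambda$ be a limit that is the least $\mathcal D$-collectively complete limit for some set of sets $\mathcal D$, or the least $H$-collectively complete limit for some broad set of sets $H$. Then $\lambda$ is regular.
   Context: Ambient theory: the Base Theory (intuitionistic set theory with urelements allowed and no Foundation, with Extensionality, Inhabitation, Empty Set, Pairing, Union, Replacement, Truth Value Separation, Infinity, Exponentiation; no Excluded Middle, Choice or Powerset). Ordinals: $\mathsf{Ord}$ is the least class such that every transitive set all of whose elements are in it belongs to it; $\alpha<\beta$ means $\alpha\in\beta$, $\alpha\le\beta$ means $\alpha\subseteq\beta$, $\alpha^+=\alpha\cup\{\alpha\}$, suprema are unions. For a set $K$, $\lambda$ is $K$-complete if for every function $k\mapsto\alpha_k$ from $K$ to $\lambda$, $\bigcup_k\alpha_k<\lambda$. A limit is an ordinal $\lambda$ with $0<\lambda$, $\alpha<\lambda\Rightarrow\alpha^+<\lambda$, and $\alpha,\beta<\lambda\Rightarrow\alpha\cup\beta<\lambda$. For a set of sets $\mathcal D$, $\lambda$ is $\mathcal D$-collectively complete if $K$-complete for all $K\in\mathcal D$. A broad set of sets is a class function $H$ from ordinals to sets of sets; $\lambda$ is $H$-collectively complete if it is $H(\beta)$-collectively complete for all $\beta<\lambda$. A limit $\lambda$ is regular if it is $\beta$-complete for every $\beta<\lambda$. -}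

module Defs where

open import Level using (Level; _⊔_) renaming (suc to lsuc)
open import Data.Product using (Σ; Σ-syntax; _×_; _,_)
open import Data.Sum using (_⊎_)
open import Data.Empty using (⊥)
open import Relation.Nullary using (¬_)
open import Relation.Binary.PropositionalEquality using (_≡_)

_⇔_ : ∀ {a b} → Set a → Set b → Set (a ⊔ b)
A ⇔ B = (A → B) × (B → A)
infix 2 _⇔_

-- Language: a universe U of objects (sets and urelements), a membership
-- relation, and a predicate isSet distinguishing sets from urelements.
-- Equality of the object language is interpreted as Agda's _≡_.
-- Classes / formulas are interpreted as Agda predicates (U → Set ℓ).

record Language (ℓ : Level) : Set (lsuc ℓ) where
  field
    U     : Set ℓ
    _∈_   : U → U → Set ℓ
    isSet : U → Set ℓ
  infix 4 _∈_

module Notions {ℓ : Level} (L : Language ℓ) where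
  open Language L

  _⊆_ : U → U → Set ℓ
  x ⊆ y = ∀ z → z ∈ x → z ∈ y

  IsEmpty : U → Set ℓ
  IsEmpty e = isSet e × (∀ z → ¬ (z ∈ e))

  IsSingleton : U → U → Set ℓ
  IsSingleton s a = isSet s × (∀ z → z ∈ s ⇔ z ≡ a)

  IsUPair : U → U → U → Set ℓ
  IsUPair p a b = isSet p × (∀ z → z ∈ p ⇔ (z ≡ a ⊎ z ≡ b))

  IsOPair : U → U → U → Set ℓ
  IsOPair p a b = isSet p × (∀ z → z ∈ p ⇔ (IsSingleton z a ⊎ IsUPair z a b))

  IsBinUnion : U → U → U → Set ℓ
  IsBinUnion u x y = isSet u × (∀ z → z ∈ u ⇔ (z ∈ x ⊎ z ∈ y))

  IsUnion : U → U → Set ℓ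
  IsUnion u x = isSet u × (∀ z → z ∈ u ⇔ (Σ[ y ∈ U ] (y ∈ x × z ∈ y)))

  IsSucc : U → U → Set ℓ
  IsSucc s x = isSet s × (∀ z → z ∈ s ⇔ (z ∈ x ⊎ z ≡ x))

  IsFunction : U → U → U → Set ℓ
  IsFunction f A B =
    isSet f
    × (∀ p → p ∈ f → Σ[ a ∈ U ] Σ[ b ∈ U ] (a ∈ A × b ∈ B × IsOPair p a b))
    × (∀ a → a ∈ A → Σ[ b ∈ U ] Σ[ p ∈ U ] (p ∈ f × IsOPair p a b))
    × (∀ a b b′ p p′ → p ∈ f → p′ ∈ f → IsOPair p a b → IsOPair p′ a b′ → b ≡ b′)

  SetOfSets : U → Set ℓ
  SetOfSets D = isSet D × (∀ K → K ∈ D → isSet K)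

-- The Base Theory: Extensionality, Inhabitation, Empty Set, Pairing,
-- Union, Replacement, Truth Value Separation, Infinity, Exponentiation.
-- (No Foundation, Excluded Middle, Choice, Powerset.)

record BaseTheory (ℓ : Level) : Set (lsuc ℓ) where
  field
    language : Language ℓ
  open Language language public
  open Notions language public
  field
    extensionality : ∀ x y → isSet x → isSet y → (∀ z → z ∈ x ⇔ z ∈ y) → x ≡ y
    inhabitation   : ∀ x y → y ∈ x → isSet x
    emptySet       : Σ[ e ∈ U ] IsEmpty e
    pairing        : ∀ a b → Σ[ p ∈ U ] IsUPair p a b
    union          : ∀ x → isSet x → Σ[ u ∈ U ] IsUnion u x
    replacement    : (R : U → U → Set ℓ) → ∀ x → isSet x →
                     (∀ y → y ∈ x → Σ[ z ∈ U ] (R y z × (∀ z′ → R y z′ → z′ ≡ z))) →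
                     Σ[ r ∈ U ] (isSet r × (∀ z → z ∈ r ⇔ (Σ[ y ∈ U ] (y ∈ x × R y z))))
    truthValueSeparation : ∀ x → isSet x → (P : Set ℓ) →
                     Σ[ s ∈ U ] (isSet s × (∀ z → z ∈ s ⇔ (z ∈ x × P)))
    infinity       : Σ[ I ∈ U ] (isSet I
                       × (Σ[ e ∈ U ] (IsEmpty e × e ∈ I))
                       × (∀ y → y ∈ I → Σ[ s ∈ U ] (IsSucc s y × s ∈ I)))
    exponentiation : ∀ A B → isSet A → isSet B →
                     Σ[ E ∈ U ] (isSet E × (∀ f → f ∈ E ⇔ IsFunction f A B))

module Ordinals {ℓ : Level} (M : BaseTheory ℓ) where
  open BaseTheory M

  IsTransitive : U → Set ℓ
  IsTransitive x = ∀ y z → y ∈ x → z ∈ y → z ∈ x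

  data Ord : U → Set ℓ where
    ord : ∀ {x} → isSet x → IsTransitive x → (∀ y → y ∈ x → Ord y) → Ord x

  Complete : U → U → Set ℓ
  Complete K l =
    ∀ f → IsFunction f K l →
    ∀ u → isSet u →
      (∀ z → z ∈ u ⇔ (Σ[ k ∈ U ] Σ[ α ∈ U ] Σ[ p ∈ U ]
                        (k ∈ K × p ∈ f × IsOPair p k α × z ∈ α))) →
      u ∈ l

  IsLimit : U → Set ℓ
  IsLimit l =
    Ord l
    × (Σ[ e ∈ U ] (IsEmpty e × e ∈ l))
    × (∀ α → α ∈ l → ∀ s → IsSucc s α → s ∈ l)
    × (∀ α β → α ∈ l → β ∈ l → ∀ u → IsBinUnion u α β → u ∈ l)

  DCollComplete : U → U → Set ℓ
  DCollComplete D l = ∀ K → K ∈ D → Complete K l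

  IsBroad : (U → U) → Set ℓ
  IsBroad H = ∀ β → Ord β → SetOfSets (H β)

  HCollComplete : (U → U) → U → Set ℓ
  HCollComplete H l = ∀ β → β ∈ l → DCollComplete (H β) l

  LeastDCollLimit : U → U → Set ℓ
  LeastDCollLimit D l =
    IsLimit l × DCollComplete D l × (∀ μ → IsLimit μ → DCollComplete D μ → l ⊆ μ)

  LeastHCollLimit : (U → U) → U → Set ℓ
  LeastHCollLimit H l =
    IsLimit l × HCollComplete H l × (∀ μ → IsLimit μ → HCollComplete H μ → l ⊆ μ)

  IsRegular : U → Set ℓ
  IsRegular l = IsLimit l × (∀ β → β ∈ l → Complete β l)

{-# OPTIONS --safe #-}

-- Let μ be the set of β < λ such that λ is γ-complete for every γ ≤ β. Then μ is a limit,
-- and μ inherits every K-completeness of λ: for k ↦ α_k from K to μ, the supremum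
-- v = ⋃ α_k lies in λ, and for a function f on v the union ⋃_{x ∈ v} f x is the K-indexed
-- union of the values ⋃_{x ∈ α_k} f x, each of which lies in λ because α_k ∈ μ. Hence μ is
-- 𝒟- (resp. H-) collectively complete, minimality of λ gives λ ⊆ μ, and so λ is regular.

module Submission where

open import Defs
open import Level using (Level)
open import Data.Product using (Σ-syntax; _×_; _,_; proj₁; proj₂)
open import Data.Sum using (_⊎_; inj₁; inj₂; [_,_]′; map₂; reduce)
open import Data.Empty using (⊥-elim)
open import Relation.Binary.PropositionalEquality using (_≡_; refl; sym; trans; subst; subst₂)

module _ {ℓ : Level} (M : BaseTheory ℓ) where
  open BaseTheory M
  open Ordinals M

  private variable
    f g h x y s t u v w A B C K α β a b c k z : U

  Characterises : U → (U → Set ℓ) → Set ℓ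
  Characterises x Φ = isSet x × (∀ z → z ∈ x ⇔ Φ z)

  characterised-unique : (Φ : U → Set ℓ) → Characterises x Φ → Characterises y Φ → x ≡ y
  characterised-unique {x} {y} Φ (x-set , x⇔) (y-set , y⇔) = extensionality x y x-set y-set λ z →
    (λ z∈x → proj₂ (y⇔ z) (proj₁ (x⇔ z) z∈x)) , (λ z∈y → proj₂ (x⇔ z) (proj₁ (y⇔ z) z∈y))

  singleton-exists : ∀ a → Σ[ s ∈ U ] IsSingleton s a
  singleton-exists a =
    let (p , p-set , p⇔) = pairing a a
    in p , p-set , λ z → (λ z∈p → reduce (proj₁ (p⇔ z) z∈p)) , (λ z≡a → proj₂ (p⇔ z) (inj₁ z≡a))

  -- Only truth-value separation is an axiom: a class Φ is separated pointwise as
  -- {z ∈ {y} | Φ y} for y ∈ x, and the pieces are collected by Replacement and Union.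
  separation : isSet x → (Φ : U → Set ℓ) → Σ[ s ∈ U ] Characterises s (λ z → z ∈ x × Φ z)
  separation {x} x-set Φ =
    let (r , r-set , r⇔) = replacement Piece x x-set λ y _ →
          let (s , s-piece) = piece y
          in s , s-piece , λ s′ s′-piece → characterised-unique (λ z → z ≡ y × Φ y) s′-piece s-piece
        (m , m-set , m⇔) = union r r-set
    in m , m-set , λ z →
      (λ z∈m → let (s , s∈r , z∈s) = proj₁ (m⇔ z) z∈m
                   (y , y∈x , _ , s⇔) = proj₁ (r⇔ s) s∈r
                   (z≡y , Φy) = proj₁ (s⇔ z) z∈s
               in subst (_∈ x) (sym z≡y) y∈x , subst Φ (sym z≡y) Φy) ,
      (λ (z∈x , Φz) → let (s , s-piece) = piece z
                      in proj₂ (m⇔ z) (s , proj₂ (r⇔ s) (z , z∈x , s-piece) ,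
                                       proj₂ (proj₂ s-piece z) (refl , Φz)))
    where
    Piece : U → U → Set ℓ
    Piece y s = Characterises s (λ z → z ≡ y × Φ y)

    piece : ∀ y → Σ[ s ∈ U ] Piece y s
    piece y =
      let (t , t-set , t⇔) = singleton-exists y
          (s , s-set , s⇔) = truthValueSeparation t t-set (Φ y)
      in s , s-set , λ z →
        (λ z∈s → let (z∈t , Φy) = proj₁ (s⇔ z) z∈s in proj₁ (t⇔ z) z∈t , Φy) ,
        (λ (z≡y , Φy) → proj₂ (s⇔ z) (proj₂ (t⇔ z) z≡y , Φy))

  succ-∪ : IsSucc s α → IsSingleton t α → ∀ k → k ∈ s ⇔ (k ∈ α ⊎ k ∈ t)
  succ-∪ (_ , s⇔) (_ , t⇔) k =
    (λ k∈s → map₂ (proj₂ (t⇔ k)) (proj₁ (s⇔ k) k∈s)) , (λ k∈α∪t → proj₂ (s⇔ k) (map₂ (proj₁ (t⇔ k)) k∈α∪t))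

  opair-exists : ∀ a b → Σ[ p ∈ U ] IsOPair p a b
  opair-exists a b =
    let (s , s-single) = singleton-exists a
        (t , t-pair) = pairing a b
        (p , p-set , p⇔) = pairing s t
    in p , p-set , λ z →
      (λ z∈p → [ (λ z≡s → inj₁ (subst (λ w → IsSingleton w a) (sym z≡s) s-single)) ,
                 (λ z≡t → inj₂ (subst (λ w → IsUPair w a b) (sym z≡t) t-pair)) ]′ (proj₁ (p⇔ z) z∈p)) ,
      [ (λ z-single → proj₂ (p⇔ z) (inj₁ (characterised-unique (_≡ a) z-single s-single))) ,
        (λ z-pair → proj₂ (p⇔ z) (inj₂ (characterised-unique (λ w → w ≡ a ⊎ w ≡ b) z-pair t-pair))) ]′

  opair-unique : ∀ {p q} → IsOPair p a b → IsOPair q a b → p ≡ q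
  opair-unique {a} {b} = characterised-unique (λ z → IsSingleton z a ⊎ IsUPair z a b)

  opair-injectiveˡ : ∀ {p} → IsOPair p a b → IsOPair p c y → a ≡ c
  opair-injectiveˡ {a} {c = c} (_ , p⇔) (_ , p⇔′) =
    let (s , s-single) = singleton-exists a
        c∈s = [ (λ s-single′ → proj₂ (proj₂ s-single′ c) refl) ,
                (λ s-pair′ → proj₂ (proj₂ s-pair′ c) (inj₁ refl)) ]′ (proj₁ (p⇔′ s) (proj₂ (p⇔ s) (inj₁ s-single)))
    in sym (proj₁ (proj₂ s-single c) c∈s)

  private
    opair-second-cases : ∀ {p} → IsOPair p a b → IsOPair p a c → b ≡ a ⊎ b ≡ c
    opair-second-cases {a} {b} (_ , p⇔) (_ , p⇔′) =
      let (t , t-pair) = pairing a b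
          b∈t = proj₂ (proj₂ t-pair b) (inj₂ refl)
      in [ (λ t-single → inj₁ (proj₁ (proj₂ t-single b) b∈t)) ,
           (λ t-pair′ → proj₁ (proj₂ t-pair′ b) b∈t) ]′ (proj₁ (p⇔′ t) (proj₂ (p⇔ t) (inj₂ t-pair)))

    both-cases : b ≡ a ⊎ b ≡ c → c ≡ a ⊎ c ≡ b → b ≡ c
    both-cases (inj₂ b≡c) _ = b≡c
    both-cases (inj₁ _) (inj₂ c≡b) = sym c≡b
    both-cases (inj₁ b≡a) (inj₁ c≡a) = trans b≡a (sym c≡a)

  opair-injectiveʳ : ∀ {p} → IsOPair p a b → IsOPair p c y → b ≡ y
  opair-injectiveʳ P P′ with opair-injectiveˡ P P′
  ... | refl = both-cases (opair-second-cases P P′) (opair-second-cases P′ P)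

  infix 4 _∋_↦_
  _∋_↦_ : U → U → U → Set ℓ
  f ∋ k ↦ a = Σ[ p ∈ U ] (p ∈ f × IsOPair p k a)

  fun-total : IsFunction f A B → k ∈ A → Σ[ b ∈ U ] f ∋ k ↦ b
  fun-total (_ , _ , total , _) = total _

  fun-unique : IsFunction f A B → f ∋ k ↦ b → f ∋ k ↦ c → b ≡ c
  fun-unique (_ , _ , _ , functional) (p , p∈f , kb) (q , q∈f , kc) = functional _ _ _ p q p∈f q∈f kb kc

  fun-value : IsFunction f A B → f ∋ k ↦ b → b ∈ B
  fun-value {B = B} (_ , pairs , _) (p , p∈f , kb) =
    let (_ , b′ , _ , b′∈B , k′b′) = pairs p p∈f in subst (_∈ B) (opair-injectiveʳ k′b′ kb) b′∈B

  fun-weaken-codomain : B ⊆ C → IsFunction f A B → IsFunction f A C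
  fun-weaken-codomain B⊆C (f-set , pairs , total , functional) =
    f-set , (λ p p∈f → let (a , b , a∈A , b∈B , ab) = pairs p p∈f in a , b , a∈A , B⊆C b b∈B , ab) ,
    total , functional

  function-exists : (F : U → U → Set ℓ) → isSet K →
    (∀ k → k ∈ K → Σ[ b ∈ U ] (b ∈ B × F k b)) →
    (∀ {k b c} → F k b → F k c → b ≡ c) →
    Σ[ h ∈ U ] (IsFunction h K B × (∀ {k b} → h ∋ k ↦ b → F k b))
  function-exists {K} {B} F K-set values F-unique =
    r , (r-set , pairs , total , λ _ _ _ p q p∈r q∈r kb kc → F-unique (graph (p , p∈r , kb)) (graph (q , q∈r , kc))) ,
    graph
    where
    Pair : U → U → Set ℓ
    Pair k q = Σ[ b ∈ U ] (b ∈ B × F k b × IsOPair q k b)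

    pair : ∀ k → k ∈ K → Σ[ q ∈ U ] Pair k q
    pair k k∈K = let (b , b∈B , Fkb) = values k k∈K
                     (q , kb) = opair-exists k b
                 in q , b , b∈B , Fkb , kb

    pair-unique : ∀ {k q q′} → Pair k q → Pair k q′ → q′ ≡ q
    pair-unique (b , _ , Fkb , kb) (c , _ , Fkc , kc) = opair-unique (subst (IsOPair _ _) (F-unique Fkc Fkb) kc) kb

    r-data : Σ[ s ∈ U ] (isSet s × (∀ q → q ∈ s ⇔ (Σ[ k ∈ U ] (k ∈ K × Pair k q))))
    r-data = replacement Pair K K-set λ k k∈K →
      let (q , kq) = pair k k∈K in q , kq , λ q′ kq′ → pair-unique kq kq′

    r : U
    r = proj₁ r-data

    r-set : isSet r
    r-set = proj₁ (proj₂ r-data)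

    r⇔ : ∀ q → q ∈ r ⇔ (Σ[ k ∈ U ] (k ∈ K × Pair k q))
    r⇔ = proj₂ (proj₂ r-data)

    pairs : ∀ q → q ∈ r → Σ[ k ∈ U ] Σ[ b ∈ U ] (k ∈ K × b ∈ B × IsOPair q k b)
    pairs q q∈r = let (k , k∈K , b , b∈B , _ , kb) = proj₁ (r⇔ q) q∈r in k , b , k∈K , b∈B , kb

    total : ∀ k → k ∈ K → Σ[ b ∈ U ] r ∋ k ↦ b
    total k k∈K = let (q , kq) = pair k k∈K
                      (b , _ , _ , kb) = kq
                  in b , q , proj₂ (r⇔ q) (k , k∈K , kq) , kb

    graph : ∀ {k b} → r ∋ k ↦ b → F k b
    graph (q , q∈r , kb) = let (_ , _ , c , _ , Fk′c , k′c) = proj₁ (r⇔ q) q∈r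
                           in subst₂ F (opair-injectiveˡ k′c kb) (opair-injectiveʳ k′c kb) Fk′c

  -- u = ⋃_{k ∈ α} f k; written out so that  Complete K l  unfolds to it.
  IsIndexedUnion : U → U → U → Set ℓ
  IsIndexedUnion u f α =
    ∀ z → z ∈ u ⇔ (Σ[ k ∈ U ] Σ[ a ∈ U ] Σ[ p ∈ U ] (k ∈ α × p ∈ f × IsOPair p k a × z ∈ a))

  ∈-indexedUnion : IsIndexedUnion u f α → k ∈ α → f ∋ k ↦ a → z ∈ a → z ∈ u
  ∈-indexedUnion u⇔ k∈α (p , p∈f , ka) z∈a = proj₂ (u⇔ _) (_ , _ , p , k∈α , p∈f , ka , z∈a)

  indexedUnion-∈ : IsIndexedUnion u f α → z ∈ u → Σ[ k ∈ U ] Σ[ a ∈ U ] (k ∈ α × f ∋ k ↦ a × z ∈ a)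
  indexedUnion-∈ u⇔ z∈u =
    let (k , a , p , k∈α , p∈f , ka , z∈a) = proj₁ (u⇔ _) z∈u in k , a , k∈α , (p , p∈f , ka) , z∈a

  indexedUnion-unique : isSet u → isSet v → IsIndexedUnion u f α → IsIndexedUnion v f α → u ≡ v
  indexedUnion-unique u-set v-set u⇔ v⇔ = characterised-unique _ (u-set , u⇔) (v-set , v⇔)

  indexedUnion-exists : IsFunction f A B → isSet α → α ⊆ A → Σ[ u ∈ U ] (isSet u × IsIndexedUnion u f α)
  indexedUnion-exists {f} {α = α} f-fun α-set α⊆A =
    let (r , r-set , r⇔) = replacement (f ∋_↦_) α α-set λ k k∈α →
          let (b , kb) = fun-total f-fun (α⊆A k k∈α) in b , kb , λ c kc → fun-unique f-fun kc kb
        (u , u-set , u⇔) = union r r-set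
    in u , u-set , λ z →
      (λ z∈u → let (a , a∈r , z∈a) = proj₁ (u⇔ z) z∈u
                   (k , k∈α , p , p∈f , ka) = proj₁ (r⇔ a) a∈r
               in k , a , p , k∈α , p∈f , ka , z∈a) ,
      (λ (k , a , p , k∈α , p∈f , ka , z∈a) → proj₂ (u⇔ z) (a , proj₂ (r⇔ a) (k , k∈α , p , p∈f , ka) , z∈a))

  indexedUnion-∅ : IsEmpty α → isSet u → IsIndexedUnion u f α → u ≡ α
  indexedUnion-∅ {α} {u} (α-set , α-empty) u-set u⇔ = extensionality u α u-set α-set λ z →
    (λ z∈u → let (k , _ , k∈α , _) = indexedUnion-∈ u⇔ z∈u in ⊥-elim (α-empty k k∈α)) ,
    (λ z∈α → ⊥-elim (α-empty z z∈α))

  indexedUnion-singleton : IsFunction f A B → IsSingleton t a → f ∋ a ↦ b → IsIndexedUnion b f t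
  indexedUnion-singleton {a = a} f-fun (_ , t⇔) (p , p∈f , ab) z =
    (λ z∈b → a , _ , p , proj₂ (t⇔ a) refl , p∈f , ab , z∈b) ,
    (λ (k , c , q , k∈t , q∈f , kc , z∈c) →
       let k≡a = proj₁ (t⇔ k) k∈t
       in subst (z ∈_) (fun-unique f-fun (q , q∈f , subst (λ k → IsOPair q k c) k≡a kc) (p , p∈f , ab)) z∈c)

  indexedUnion-∪ : (∀ k → k ∈ w ⇔ (k ∈ α ⊎ k ∈ β)) →
    IsIndexedUnion a f α → IsIndexedUnion b f β → IsIndexedUnion u f w → ∀ z → z ∈ u ⇔ (z ∈ a ⊎ z ∈ b)
  indexedUnion-∪ w⇔ a⇔ b⇔ u⇔ z =
    (λ z∈u → let (k , c , k∈w , kc , z∈c) = indexedUnion-∈ u⇔ z∈u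
             in [ (λ k∈α → inj₁ (∈-indexedUnion a⇔ k∈α kc z∈c)) ,
                  (λ k∈β → inj₂ (∈-indexedUnion b⇔ k∈β kc z∈c)) ]′ (proj₁ (w⇔ k) k∈w)) ,
    [ (λ z∈a → let (k , c , k∈α , kc , z∈c) = indexedUnion-∈ a⇔ z∈a
               in ∈-indexedUnion u⇔ (proj₂ (w⇔ k) (inj₁ k∈α)) kc z∈c) ,
      (λ z∈b → let (k , c , k∈β , kc , z∈c) = indexedUnion-∈ b⇔ z∈b
               in ∈-indexedUnion u⇔ (proj₂ (w⇔ k) (inj₂ k∈β)) kc z∈c) ]′

  indexedUnion-assoc : IsFunction g K B → IsFunction h K C → IsIndexedUnion v g K →
    (∀ {k w} → h ∋ k ↦ w → Σ[ a ∈ U ] (g ∋ k ↦ a × IsIndexedUnion w f a)) →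
    IsIndexedUnion u f v → IsIndexedUnion u h K
  indexedUnion-assoc g-fun h-fun v⇔ h-graph u⇔ z =
    (λ z∈u → let (x , c , x∈v , xc , z∈c) = indexedUnion-∈ u⇔ z∈u
                 (k , a , k∈K , ka , x∈a) = indexedUnion-∈ v⇔ x∈v
                 (w , q , q∈h , kw) = fun-total h-fun k∈K
                 (a′ , ka′ , w⇔) = h-graph (q , q∈h , kw)
                 x∈a′ = subst (x ∈_) (fun-unique g-fun ka ka′) x∈a
             in k , w , q , k∈K , q∈h , kw , ∈-indexedUnion w⇔ x∈a′ xc z∈c) ,
    (λ (k , w , q , k∈K , q∈h , kw , z∈w) →
       let (a , ka , w⇔) = h-graph (q , q∈h , kw)
           (x , c , x∈a , xc , z∈c) = indexedUnion-∈ w⇔ z∈w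
       in ∈-indexedUnion u⇔ (∈-indexedUnion v⇔ k∈K ka x∈a) xc z∈c)

  ord-isSet : Ord x → isSet x
  ord-isSet (ord x-set _ _) = x-set

  ord-transitive : Ord x → IsTransitive x
  ord-transitive (ord _ x-trans _) = x-trans

  ord-∈ : Ord x → y ∈ x → Ord y
  ord-∈ (ord _ _ x-ords) = x-ords _

  module CompletePart (l : U) (l-limit : IsLimit l) where
    l-ord : Ord l
    l-ord = proj₁ l-limit

    ∅ : U
    ∅ = proj₁ (proj₁ (proj₂ l-limit))

    ∅-empty : IsEmpty ∅
    ∅-empty = proj₁ (proj₂ (proj₁ (proj₂ l-limit)))

    ∅∈l : ∅ ∈ l
    ∅∈l = proj₂ (proj₂ (proj₁ (proj₂ l-limit)))

    l-succ : ∀ α → α ∈ l → ∀ s → IsSucc s α → s ∈ l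
    l-succ = proj₁ (proj₂ (proj₂ l-limit))

    l-∪ : ∀ α β → α ∈ l → β ∈ l → ∀ u → IsBinUnion u α β → u ∈ l
    l-∪ = proj₂ (proj₂ (proj₂ l-limit))

    -- α-completeness, stated for functions on any superset of α so that no restriction
    -- of a function ever has to be formed.
    Complete⊆ : U → Set ℓ
    Complete⊆ α = ∀ A f → α ⊆ A → IsFunction f A l → ∀ u → isSet u → IsIndexedUnion u f α → u ∈ l

    HereditarilyComplete : U → Set ℓ
    HereditarilyComplete α = ∀ γ → γ ∈ α ⊎ γ ≡ α → Complete⊆ γ

    complete⊆-∅ : Complete⊆ ∅
    complete⊆-∅ _ _ _ _ u u-set u⇔ = subst (_∈ l) (sym (indexedUnion-∅ ∅-empty u-set u⇔)) ∅∈l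

    complete⊆-singleton : IsSingleton t a → Complete⊆ t
    complete⊆-singleton {a = a} t-single@(_ , t⇔) A f t⊆A f-fun u u-set u⇔ =
      let (b , ab) = fun-total f-fun (t⊆A a (proj₂ (t⇔ a) refl))
          b∈l = fun-value f-fun ab
          b-set = ord-isSet (ord-∈ l-ord b∈l)
      in subst (_∈ l) (indexedUnion-unique b-set u-set (indexedUnion-singleton f-fun t-single ab) u⇔) b∈l

    complete⊆-∪ : isSet α → isSet β → (∀ k → k ∈ w ⇔ (k ∈ α ⊎ k ∈ β)) →
      Complete⊆ α → Complete⊆ β → Complete⊆ w
    complete⊆-∪ α-set β-set w⇔ α-complete β-complete A f w⊆A f-fun u u-set u⇔ =
      let α⊆A = λ k k∈α → w⊆A k (proj₂ (w⇔ k) (inj₁ k∈α))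
          β⊆A = λ k k∈β → w⊆A k (proj₂ (w⇔ k) (inj₂ k∈β))
          (a , a-set , a⇔) = indexedUnion-exists f-fun α-set α⊆A
          (b , b-set , b⇔) = indexedUnion-exists f-fun β-set β⊆A
      in l-∪ a b (α-complete A f α⊆A f-fun a a-set a⇔) (β-complete A f β⊆A f-fun b b-set b⇔)
             u (u-set , indexedUnion-∪ w⇔ a⇔ b⇔ u⇔)

    hereditarilyComplete-singleton : IsSingleton t a → HereditarilyComplete a → HereditarilyComplete t
    hereditarilyComplete-singleton (_ , t⇔) a-hc γ (inj₁ γ∈t) = a-hc γ (inj₂ (proj₁ (t⇔ γ) γ∈t))
    hereditarilyComplete-singleton t-single _ _ (inj₂ refl) = complete⊆-singleton t-single

    hereditarilyComplete-∪ : isSet α → isSet β → (∀ k → k ∈ w ⇔ (k ∈ α ⊎ k ∈ β)) →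
      HereditarilyComplete α → HereditarilyComplete β → HereditarilyComplete w
    hereditarilyComplete-∪ _ _ w⇔ α-hc β-hc γ (inj₁ γ∈w) =
      [ (λ γ∈α → α-hc γ (inj₁ γ∈α)) , (λ γ∈β → β-hc γ (inj₁ γ∈β)) ]′ (proj₁ (w⇔ γ) γ∈w)
    hereditarilyComplete-∪ α-set β-set w⇔ α-hc β-hc _ (inj₂ refl) =
      complete⊆-∪ α-set β-set w⇔ (α-hc _ (inj₂ refl)) (β-hc _ (inj₂ refl))

    μ-data : Σ[ μ ∈ U ] Characterises μ (λ z → z ∈ l × HereditarilyComplete z)
    μ-data = separation (ord-isSet l-ord) HereditarilyComplete

    μ : U
    μ = proj₁ μ-data

    μ⊆l : α ∈ μ → α ∈ l
    μ⊆l α∈μ = proj₁ (proj₁ (proj₂ (proj₂ μ-data) _) α∈μ)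

    μ-hereditarilyComplete : α ∈ μ → HereditarilyComplete α
    μ-hereditarilyComplete α∈μ = proj₂ (proj₁ (proj₂ (proj₂ μ-data) _) α∈μ)

    ∈μ : α ∈ l → HereditarilyComplete α → α ∈ μ
    ∈μ α∈l α-hc = proj₂ (proj₂ (proj₂ μ-data) _) (α∈l , α-hc)

    μ-ord : α ∈ μ → Ord α
    μ-ord α∈μ = ord-∈ l-ord (μ⊆l α∈μ)

    μ-transitive : IsTransitive μ
    μ-transitive y z y∈μ z∈y = ∈μ (ord-transitive l-ord y z (μ⊆l y∈μ) z∈y) λ where
      γ (inj₁ γ∈z) → μ-hereditarilyComplete y∈μ γ (inj₁ (ord-transitive (μ-ord y∈μ) z γ z∈y γ∈z))
      _ (inj₂ refl) → μ-hereditarilyComplete y∈μ z (inj₁ z∈y)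

    ∅∈μ : ∅ ∈ μ
    ∅∈μ = ∈μ ∅∈l λ where
      γ (inj₁ γ∈∅) → ⊥-elim (proj₂ ∅-empty γ γ∈∅)
      _ (inj₂ refl) → complete⊆-∅

    μ-succ : ∀ α → α ∈ μ → ∀ s → IsSucc s α → s ∈ μ
    μ-succ α α∈μ s s-succ =
      let (t , t-single) = singleton-exists α
          α-hc = μ-hereditarilyComplete α∈μ
      in ∈μ (l-succ α (μ⊆l α∈μ) s s-succ)
            (hereditarilyComplete-∪ (ord-isSet (μ-ord α∈μ)) (proj₁ t-single) (succ-∪ s-succ t-single)
               α-hc (hereditarilyComplete-singleton t-single α-hc))

    μ-∪ : ∀ α β → α ∈ μ → β ∈ μ → ∀ w → IsBinUnion w α β → w ∈ μ
    μ-∪ α β α∈μ β∈μ w w-union@(_ , w⇔) =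
      ∈μ (l-∪ α β (μ⊆l α∈μ) (μ⊆l β∈μ) w w-union)
         (hereditarilyComplete-∪ (ord-isSet (μ-ord α∈μ)) (ord-isSet (μ-ord β∈μ)) w⇔
            (μ-hereditarilyComplete α∈μ) (μ-hereditarilyComplete β∈μ))

    μ-limit : IsLimit μ
    μ-limit = ord (proj₁ (proj₂ μ-data)) μ-transitive (λ _ → μ-ord) , (∅ , ∅-empty , ∅∈μ) , μ-succ , μ-∪

    complete⊆-indexedUnion : isSet K → Complete K l → IsFunction g K μ → IsIndexedUnion v g K → Complete⊆ v
    complete⊆-indexedUnion {K} {g} K-set K-complete g-fun v⇔ A f v⊆A f-fun u u-set u⇔ =
      let (h , h-fun , h-graph) = function-exists Value K-set value value-unique
      in K-complete h h-fun u u-set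
           (indexedUnion-assoc g-fun h-fun v⇔ (λ kw → proj₂ (h-graph kw)) u⇔)
      where
      Value : U → U → Set ℓ
      Value k w = isSet w × Σ[ a ∈ U ] (g ∋ k ↦ a × IsIndexedUnion w f a)

      value : ∀ k → k ∈ K → Σ[ w ∈ U ] (w ∈ l × Value k w)
      value k k∈K =
        let (a , ka) = fun-total g-fun k∈K
            a∈μ = fun-value g-fun ka
            a⊆A = λ x x∈a → v⊆A x (∈-indexedUnion v⇔ k∈K ka x∈a)
            (w , w-set , w⇔) = indexedUnion-exists f-fun (ord-isSet (μ-ord a∈μ)) a⊆A
        in w , μ-hereditarilyComplete a∈μ a (inj₂ refl) A f a⊆A f-fun w w-set w⇔ , w-set , a , ka , w⇔

      value-unique : ∀ {k w w′} → Value k w → Value k w′ → w ≡ w′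
      value-unique (w-set , a , ka , w⇔) (w′-set , a′ , ka′ , w′⇔) with fun-unique g-fun ka ka′
      ... | refl = indexedUnion-unique w-set w′-set w⇔ w′⇔

    μ-complete : isSet K → Complete K l → Complete K μ
    μ-complete K-set K-complete g g-fun v v-set v⇔ =
      ∈μ (K-complete g (fun-weaken-codomain (λ _ → μ⊆l) g-fun) v v-set v⇔) λ where
        γ (inj₁ γ∈v) → let (k , a , k∈K , ka , γ∈a) = indexedUnion-∈ v⇔ γ∈v
                       in μ-hereditarilyComplete (fun-value g-fun ka) γ (inj₁ γ∈a)
        _ (inj₂ refl) → complete⊆-indexedUnion K-set K-complete g-fun v⇔

    l⊆μ⇒regular : l ⊆ μ → IsRegular l
    l⊆μ⇒regular l⊆μ = l-limit , λ β β∈l f f-fun u u-set u⇔ →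
      μ-hereditarilyComplete (l⊆μ β β∈l) β (inj₂ refl) β f (λ _ k∈β → k∈β) f-fun u u-set u⇔

proposition7p11 : {ℓ : Level} (M : BaseTheory ℓ) (l : BaseTheory.U M) →
    Ordinals.IsLimit M l →
    ((Σ[ D ∈ BaseTheory.U M ] (BaseTheory.SetOfSets M D × Ordinals.LeastDCollLimit M D l))
     ⊎ (Σ[ H ∈ (BaseTheory.U M → BaseTheory.U M) ] (Ordinals.IsBroad M H × Ordinals.LeastHCollLimit M H l))) →
    Ordinals.IsRegular M l
proposition7p11 M l l-limit (inj₁ (D , (_ , D-sets) , _ , l-complete , least)) =
  l⊆μ⇒regular (least μ μ-limit λ K K∈D → μ-complete (D-sets K K∈D) (l-complete K K∈D))
  where open CompletePart M l l-limit
proposition7p11 M l l-limit (inj₂ (H , H-broad , _ , l-complete , least)) =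
  l⊆μ⇒regular (least μ μ-limit λ β β∈μ K K∈Hβ →
    μ-complete (proj₂ (H-broad β (μ-ord β∈μ)) K K∈Hβ) (l-complete β (μ⊆l β∈μ) K K∈Hβ))
  where open CompletePart M l l-limit
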